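{- Let $G$ be a finite group, $H\leq G$ a subgroup of index $n$, $T=\{t_1,\dots,t_n\}$ a right transversal with $t_1=1$, $\chi$ a linear character of $H$, and $\rho(g)=[\chi^+(t_igt_k^{ -1})]_{i,k}$ the induced monomial representation. Let $M$ be a complex $n\times n$ matrix with rows and columns labelled by $T$, and write $m(s,t)$ for its entry in row $s$ and column $t$. Then $M$ lies in the centraliser algebra $\mathrm{C}(\rho)=\{X : X\rho(g)=\rho(g)X\ \forall g\in G\}$ if and only if for all $g\in G$ and $t\in T$, $$m(\mathfrak{t}(g),\mathfrak{t}(tg))=m(1,t)\,U(g)^{ -1}U(tg).$$
   Context: Every $g\in G$ factors uniquely as $g=\mathfrak{h}(g)\mathfrak{t}(g)$ with $\mathfrak{h}(g)\in H$ and $\mathfrak{t}(g)\in T$. $\chi^+(g)=\chi(g)$ for $g\in H$ and $\chi^+(g)=0$ otherwise; $U(g)=\chi(\mathfrak{h}(g))$. Here $1=t_1\in T$. -}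

module Defs where

open import Level using (Level; _⊔_) renaming (suc to lsuc)
open import Algebra.Bundles using (Group; CommutativeRing)
open import Data.Nat using (ℕ; zero; suc)
open import Data.Fin using (Fin; zero; suc)
open import Data.Product using (Σ; ∃; _×_; _,_)
open import Relation.Binary.PropositionalEquality using (_≡_)
open import Relation.Nullary using (Dec; yes; no)
open import Relation.Unary using (Pred)

IsFiniteGroup : ∀ {c ℓ} → Group c ℓ → Set (c ⊔ ℓ)
IsFiniteGroup G = Σ ℕ λ N → Σ (Fin N → Carrier) λ e → ∀ g → ∃ λ i → e i ≈ g
  where open Group G

record Subgroup {c ℓ} (G : Group c ℓ) (p : Level) : Set (c ⊔ ℓ ⊔ lsuc p) where
  open Group G
  field
    Mem   : Pred Carrier p
    resp  : ∀ {x y} → x ≈ y → Mem x → Mem y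
    ε∈    : Mem ε
    ∙∈    : ∀ {x y} → Mem x → Mem y → Mem (x ∙ y)
    ⁻¹∈   : ∀ {x} → Mem x → Mem (x ⁻¹)
    dec   : ∀ x → Dec (Mem x)

-- A right transversal T = {T i | i : Fin n} of H in G (so H has index n):
-- every g factors uniquely as g = h t with h ∈ H, t ∈ T, i.e. there is a
-- unique index 𝔱 g with g (T (𝔱 g))⁻¹ ∈ H.
record RightTransversal {c ℓ p} (G : Group c ℓ) (H : Subgroup G p) (n : ℕ)
       : Set (c ⊔ ℓ ⊔ p) where
  open Group G
  open Subgroup H
  field
    T        : Fin n → Carrier
    𝔱        : Carrier → Fin n
    𝔱-spec   : ∀ g → Mem (g ∙ T (𝔱 g) ⁻¹)
    𝔱-unique : ∀ g j → Mem (g ∙ T j ⁻¹) → j ≡ 𝔱 g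
    i₁       : Fin n
    T-i₁     : T i₁ ≈ ε
  𝔥 : Carrier → Carrier
  𝔥 g = g ∙ T (𝔱 g) ⁻¹

record LinearChar {c ℓ p k ℓk} (G : Group c ℓ) (H : Subgroup G p)
       (K : CommutativeRing k ℓk) : Set (c ⊔ ℓ ⊔ p ⊔ k ⊔ ℓk) where
  open Subgroup H
  module G = Group G
  module K = CommutativeRing K
  field
    χ     : G.Carrier → K.Carrier
    χ⁻¹   : G.Carrier → K.Carrier
    cong  : ∀ {x y} → x G.≈ y → Mem x → χ x K.≈ χ y
    hom   : ∀ {x y} → Mem x → Mem y → χ (x G.∙ y) K.≈ (χ x K.* χ y)
    unit  : ∀ {x} → Mem x → (χ x K.* χ⁻¹ x) K.≈ K.1#

module _ {c ℓ p k ℓk} {G : Group c ℓ} {H : Subgroup G p}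
         {K : CommutativeRing k ℓk} {n : ℕ}
         (tr : RightTransversal G H n) (lc : LinearChar G H K) where
  open Group G using (_∙_; _⁻¹) renaming (Carrier to GC)
  open CommutativeRing K using (_≈_; _+_; _*_; 0#; 1#) renaming (Carrier to KC)
  open RightTransversal tr
  open LinearChar lc using (χ; χ⁻¹)

  Matrix : Set k
  Matrix = Fin n → Fin n → KC

  sumFin : ∀ {m} → (Fin m → KC) → KC
  sumFin {zero}  f = 0#
  sumFin {suc m} f = f zero + sumFin (λ i → f (suc i))

  _·_ : Matrix → Matrix → Matrix
  (A · B) i j = sumFin λ l → A i l * B l j

  χ⁺ : GC → KC
  χ⁺ g with Subgroup.dec H g
  ... | yes _ = χ g
  ... | no  _ = 0#

  ρ : GC → Matrix
  ρ g i j = χ⁺ ((T i ∙ g) ∙ T j ⁻¹)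

  U : GC → KC
  U g = χ (𝔥 g)

  U⁻¹ : GC → KC
  U⁻¹ g = χ⁻¹ (𝔥 g)

  InCentraliser : Matrix → Set (c ⊔ ℓk)
  InCentraliser X = ∀ g i j → (X · ρ g) i j ≈ (ρ g · X) i j

  MonomialCondition : Matrix → Set (c ⊔ ℓk)
  MonomialCondition X =
    ∀ g j → X (𝔱 g) (𝔱 (T j ∙ g)) ≈ (X i₁ j * (U⁻¹ g * U (T j ∙ g)))

-- The matrix ρ(g) is monomial: row i has a single nonzero entry,
-- U(t_i g), in column i ⊲ g := 𝔱(t_i g), and i ↦ i ⊲ g is the permutation
-- action of G on the right cosets of H.  So M ρ(g) = ρ(g) M says entrywise
--   m(t_i, t_j) U(t_j g) = U(t_i g) m(t_{i ⊲ g}, t_{j ⊲ g}),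
-- which for t_i = 1 is the stated condition multiplied by U(g).  Conversely
-- the condition for g and for t_i g, glued by the cocycle identity
-- U(x y) = U(x) U(𝔱(x) y), gives back the entrywise identity for every row i.
module Submission where

open import Defs
  using (IsFiniteGroup; Subgroup; RightTransversal; LinearChar; InCentraliser; MonomialCondition)
import Defs
open import Level using (_⊔_)
open import Algebra.Bundles using (Group; CommutativeRing)
import Algebra.Properties.Monoid as MonoidProperties
import Algebra.Properties.CommutativeMonoid.Sum as Sum
open import Data.Nat using (ℕ; zero; suc)
open import Data.Fin using (Fin; suc; punchIn)
open import Data.Fin.Properties using (punchInᵢ≢i)
open import Data.Product using (_×_; _,_)
open import Function using (_∘_)
open import Relation.Nullary using (¬_; yes; no; contradiction)
open import Relation.Binary.PropositionalEquality as ≡ using (_≡_; _≢_)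
import Relation.Binary.Reasoning.Setoid as SetoidReasoning

module _ {c ℓ} (G : Group c ℓ) where
  open Group G
  open SetoidReasoning setoid

  [xy]z≈[xt⁻¹][ty∙z] : ∀ x t y z → (x ∙ y) ∙ z ≈ (x ∙ t ⁻¹) ∙ ((t ∙ y) ∙ z)
  [xy]z≈[xt⁻¹][ty∙z] x t y z = begin
    (x ∙ y) ∙ z                 ≈⟨ assoc x y z ⟩
    x ∙ (y ∙ z)                 ≈⟨ MonoidProperties.cancelᶜ monoid (inverseˡ t) x (y ∙ z) ⟨
    (x ∙ t ⁻¹) ∙ (t ∙ (y ∙ z))  ≈⟨ ∙-congˡ (assoc t y z) ⟨
    (x ∙ t ⁻¹) ∙ ((t ∙ y) ∙ z)  ∎

module _ {k ℓk} (K : CommutativeRing k ℓk) where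
  open CommutativeRing K
  open SetoidReasoning setoid

  module _ {u v : Carrier} (uv≈1 : u * v ≈ 1#) where

    a≈b[vc]⇒ua≈bc : ∀ {a b c} → a ≈ b * (v * c) → u * a ≈ b * c
    a≈b[vc]⇒ua≈bc {a} {b} {c} a≈ = begin
      u * a              ≈⟨ *-congˡ a≈ ⟩
      u * (b * (v * c))  ≈⟨ *-assoc u b (v * c) ⟨
      (u * b) * (v * c)  ≈⟨ *-congʳ (*-comm u b) ⟩
      (b * u) * (v * c)  ≈⟨ *-assoc b u (v * c) ⟩
      b * (u * (v * c))  ≈⟨ *-congˡ (*-assoc u v c) ⟨
      b * ((u * v) * c)  ≈⟨ *-congˡ (*-congʳ uv≈1) ⟩
      b * (1# * c)       ≈⟨ *-congˡ (*-identityˡ c) ⟩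
      b * c              ∎

    ua≈bc⇒a≈b[vc] : ∀ {a b c} → u * a ≈ b * c → a ≈ b * (v * c)
    ua≈bc⇒a≈b[vc] {a} {b} {c} ua≈ = begin
      a                  ≈⟨ *-identityˡ a ⟨
      1# * a             ≈⟨ *-congʳ (trans (*-comm v u) uv≈1) ⟨
      (v * u) * a        ≈⟨ *-assoc v u a ⟩
      v * (u * a)        ≈⟨ *-congˡ ua≈ ⟩
      v * (b * c)        ≈⟨ *-assoc v b c ⟨
      (v * b) * c        ≈⟨ *-congʳ (*-comm v b) ⟩
      (b * v) * c        ≈⟨ *-assoc b v c ⟩
      b * (v * c)        ∎

module TransversalProperties {c ℓ p} {G : Group c ℓ} {H : Subgroup G p} {n : ℕ}
                             (tr : RightTransversal G H n) where
  open Group G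
  open Subgroup H
  open RightTransversal tr

  𝔱-cong : ∀ {x y} → x ≈ y → 𝔱 x ≡ 𝔱 y
  𝔱-cong {x} {y} x≈y = 𝔱-unique y (𝔱 x) (resp (∙-congʳ x≈y) (𝔱-spec x))

  𝔥-cong : ∀ {x y} → x ≈ y → 𝔥 x ≈ 𝔥 y
  𝔥-cong x≈y = ∙-cong x≈y (reflexive (≡.cong (λ i → T i ⁻¹) (𝔱-cong x≈y)))

  𝔱-T : ∀ i → 𝔱 (T i) ≡ i
  𝔱-T i = ≡.sym (𝔱-unique (T i) i (resp (sym (inverseʳ (T i))) ε∈))

  𝔥-T : ∀ i → 𝔥 (T i) ≈ ε
  𝔥-T i = trans (∙-congˡ (reflexive (≡.cong (λ j → T j ⁻¹) (𝔱-T i)))) (inverseʳ (T i))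

  𝔱-∙ : ∀ x y → 𝔱 (x ∙ y) ≡ 𝔱 (T (𝔱 x) ∙ y)
  𝔱-∙ x y = ≡.sym (𝔱-unique (x ∙ y) (𝔱 (T (𝔱 x) ∙ y))
    (resp (sym ([xy]z≈[xt⁻¹][ty∙z] G x (T (𝔱 x)) y _)) (∙∈ (𝔱-spec x) (𝔱-spec (T (𝔱 x) ∙ y)))))

  𝔥-∙ : ∀ x y → 𝔥 (x ∙ y) ≈ 𝔥 x ∙ 𝔥 (T (𝔱 x) ∙ y)
  𝔥-∙ x y = trans (∙-congˡ (reflexive (≡.cong (λ i → T i ⁻¹) (𝔱-∙ x y))))
                  ([xy]z≈[xt⁻¹][ty∙z] G x (T (𝔱 x)) y _)

  infixl 5 _⊲_

  _⊲_ : Fin n → Carrier → Fin n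
  i ⊲ g = 𝔱 (T i ∙ g)

  ⊲-congˡ : ∀ i {g h} → g ≈ h → i ⊲ g ≡ i ⊲ h
  ⊲-congˡ i g≈h = 𝔱-cong (∙-congˡ g≈h)

  ⊲-identityʳ : ∀ i → i ⊲ ε ≡ i
  ⊲-identityʳ i = ≡.trans (𝔱-cong (identityʳ (T i))) (𝔱-T i)

  ⊲-∙ : ∀ i g h → i ⊲ (g ∙ h) ≡ i ⊲ g ⊲ h
  ⊲-∙ i g h = ≡.trans (𝔱-cong (sym (assoc (T i) g h))) (𝔱-∙ (T i ∙ g) h)

  ⊲-inverseʳ : ∀ i g → i ⊲ g ⊲ g ⁻¹ ≡ i
  ⊲-inverseʳ i g = begin
    i ⊲ g ⊲ g ⁻¹    ≡⟨ ⊲-∙ i g (g ⁻¹) ⟨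
    i ⊲ (g ∙ g ⁻¹)  ≡⟨ ⊲-congˡ i (inverseʳ g) ⟩
    i ⊲ ε           ≡⟨ ⊲-identityʳ i ⟩
    i               ∎
    where open ≡.≡-Reasoning

  ⊲-inverseˡ : ∀ i g → i ⊲ g ⁻¹ ⊲ g ≡ i
  ⊲-inverseˡ i g = begin
    i ⊲ g ⁻¹ ⊲ g    ≡⟨ ⊲-∙ i (g ⁻¹) g ⟨
    i ⊲ (g ⁻¹ ∙ g)  ≡⟨ ⊲-congˡ i (inverseˡ g) ⟩
    i ⊲ ε           ≡⟨ ⊲-identityʳ i ⟩
    i               ∎
    where open ≡.≡-Reasoning

  T-i₁∙ : ∀ g → T i₁ ∙ g ≈ g
  T-i₁∙ g = trans (∙-congʳ T-i₁) (identityˡ g)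

  i₁⊲ : ∀ g → i₁ ⊲ g ≡ 𝔱 g
  i₁⊲ g = 𝔱-cong (T-i₁∙ g)

module _ {c ℓ p k ℓk} {G : Group c ℓ} {H : Subgroup G p} {K : CommutativeRing k ℓk}
         (lc : LinearChar G H K) where
  open Subgroup H
  open LinearChar lc
  open K
  open SetoidReasoning setoid

  χ-ε : χ G.ε ≈ 1#
  χ-ε = begin
    χ G.ε                      ≈⟨ *-identityʳ (χ G.ε) ⟨
    χ G.ε * 1#                 ≈⟨ *-congˡ (unit ε∈) ⟨
    χ G.ε * (χ G.ε * χ⁻¹ G.ε)  ≈⟨ *-assoc (χ G.ε) (χ G.ε) (χ⁻¹ G.ε) ⟨
    (χ G.ε * χ G.ε) * χ⁻¹ G.ε  ≈⟨ *-congʳ (hom ε∈ ε∈) ⟨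
    χ (G.ε G.∙ G.ε) * χ⁻¹ G.ε  ≈⟨ *-congʳ (cong (G.identityˡ G.ε) (∙∈ ε∈ ε∈)) ⟩
    χ G.ε * χ⁻¹ G.ε            ≈⟨ unit ε∈ ⟩
    1#                         ∎

module InducedRepresentation
  {c ℓ p k ℓk} {G : Group c ℓ} {H : Subgroup G p} {K : CommutativeRing k ℓk} {n : ℕ}
  (tr : RightTransversal G H n) (lc : LinearChar G H K) where

  module G = Group G
  open G using (_∙_; _⁻¹) renaming (Carrier to GC; _≈_ to _≈ᴳ_)
  open CommutativeRing K renaming (Carrier to KC)
  open Subgroup H using (Mem; dec)
  open RightTransversal tr
  open TransversalProperties tr
  open LinearChar lc using (χ; hom) renaming (cong to χ-cong; unit to χ-unit)
  open SetoidReasoning setoid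

  Matrix : Set k
  Matrix = Defs.Matrix tr lc

  sumFin : ∀ {m} → (Fin m → KC) → KC
  sumFin = Defs.sumFin tr lc

  _·_ : Matrix → Matrix → Matrix
  _·_ = Defs._·_ tr lc

  χ⁺ : GC → KC
  χ⁺ = Defs.χ⁺ tr lc

  ρ : GC → Matrix
  ρ = Defs.ρ tr lc

  U U⁻¹ : GC → KC
  U = Defs.U tr lc
  U⁻¹ = Defs.U⁻¹ tr lc

  sumFin≈sum : ∀ {m} (f : Fin m → KC) → sumFin f ≈ Sum.sum +-commutativeMonoid f
  sumFin≈sum {zero}  f = refl
  sumFin≈sum {suc m} f = +-congˡ (sumFin≈sum (f ∘ suc))

  sumFin-single : ∀ {m} (f : Fin m → KC) i → (∀ j → j ≢ i → f j ≈ 0#) → sumFin f ≈ f i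
  sumFin-single {suc m} f i vanish = begin
    sumFin f                             ≈⟨ sumFin≈sum f ⟩
    sum f                                ≈⟨ sum-remove f ⟩
    f i + sum (f ∘ punchIn i)            ≈⟨ +-congˡ (sum-cong-≋ (λ j → vanish (punchIn i j) (punchInᵢ≢i i j))) ⟩
    f i + sum {m} (λ _ → 0#)             ≈⟨ +-congˡ (sum-replicate-zero m) ⟩
    f i + 0#                             ≈⟨ +-identityʳ (f i) ⟩
    f i                                  ∎
    where open Sum +-commutativeMonoid using (sum; sum-remove; sum-cong-≋; sum-replicate-zero)

  χ⁺-∈ : ∀ {x} → Mem x → χ⁺ x ≈ χ x
  χ⁺-∈ {x} x∈H with dec x
  ... | yes _    = refl
  ... | no  x∉H = contradiction x∈H x∉H

  χ⁺-∉ : ∀ {x} → ¬ Mem x → χ⁺ x ≈ 0#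
  χ⁺-∉ {x} x∉H with dec x
  ... | yes x∈H = contradiction x∈H x∉H
  ... | no  _   = refl

  U-cong : ∀ {x y} → x ≈ᴳ y → U x ≈ U y
  U-cong {x} x≈y = χ-cong (𝔥-cong x≈y) (𝔱-spec x)

  U-T : ∀ i → U (T i) ≈ 1#
  U-T i = trans (χ-cong (𝔥-T i) (𝔱-spec (T i))) (χ-ε lc)

  U-∙ : ∀ x y → U (x ∙ y) ≈ U x * U (T (𝔱 x) ∙ y)
  U-∙ x y = trans (χ-cong (𝔥-∙ x y) (𝔱-spec (x ∙ y))) (hom (𝔱-spec x) (𝔱-spec (T (𝔱 x) ∙ y)))

  U*U⁻¹≈1 : ∀ x → U x * U⁻¹ x ≈ 1#
  U*U⁻¹≈1 x = χ-unit (𝔱-spec x)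

  ρ-≡⊲ : ∀ g i j → j ≡ i ⊲ g → ρ g i j ≈ U (T i ∙ g)
  ρ-≡⊲ g i _ ≡.refl = χ⁺-∈ (𝔱-spec (T i ∙ g))

  ρ-≢⊲ : ∀ g i j → j ≢ i ⊲ g → ρ g i j ≈ 0#
  ρ-≢⊲ g i j j≢ = χ⁺-∉ (j≢ ∘ 𝔱-unique (T i ∙ g) j)

  ρ-· : ∀ X g i j → (ρ g · X) i j ≈ U (T i ∙ g) * X (i ⊲ g) j
  ρ-· X g i j = begin
    (ρ g · X) i j                ≈⟨ sumFin-single _ (i ⊲ g) off-diagonal ⟩
    ρ g i (i ⊲ g) * X (i ⊲ g) j  ≈⟨ *-congʳ (ρ-≡⊲ g i (i ⊲ g) ≡.refl) ⟩
    U (T i ∙ g) * X (i ⊲ g) j    ∎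
    where
    off-diagonal : ∀ l → l ≢ i ⊲ g → ρ g i l * X l j ≈ 0#
    off-diagonal l l≢ = trans (*-congʳ (ρ-≢⊲ g i l l≢)) (zeroˡ (X l j))

  ·-ρ : ∀ X g i j → (X · ρ g) i j ≈ X i (j ⊲ g ⁻¹) * U (T (j ⊲ g ⁻¹) ∙ g)
  ·-ρ X g i j = begin
    (X · ρ g) i j                          ≈⟨ sumFin-single _ l₀ off-diagonal ⟩
    X i l₀ * ρ g l₀ j                      ≈⟨ *-congˡ (ρ-≡⊲ g l₀ j (≡.sym (⊲-inverseˡ j g))) ⟩
    X i l₀ * U (T l₀ ∙ g)                  ∎
    where
    l₀ = j ⊲ g ⁻¹
    off-diagonal : ∀ l → l ≢ l₀ → X i l * ρ g l j ≈ 0#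
    off-diagonal l l≢l₀ = trans (*-congˡ (ρ-≢⊲ g l j j≢)) (zeroʳ (X i l))
      where
      j≢ : j ≢ l ⊲ g
      j≢ j≡ = l≢l₀ (≡.trans (≡.sym (⊲-inverseʳ l g)) (≡.cong (_⊲ g ⁻¹) (≡.sym j≡)))

  TwistedInvariant : Matrix → Set (c ⊔ ℓk)
  TwistedInvariant X = ∀ g i j → X i j * U (T j ∙ g) ≈ U (T i ∙ g) * X (i ⊲ g) (j ⊲ g)

  InCentraliser⇒TwistedInvariant : ∀ X → InCentraliser tr lc X → TwistedInvariant X
  InCentraliser⇒TwistedInvariant X commutes g i j = begin
    X i j * U (T j ∙ g)                       ≡⟨ ≡.cong (λ l → X i l * U (T l ∙ g)) (⊲-inverseʳ j g) ⟨
    X i (j ⊲ g ⊲ g ⁻¹) * U (T (j ⊲ g ⊲ g ⁻¹) ∙ g)  ≈⟨ ·-ρ X g i (j ⊲ g) ⟨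
    (X · ρ g) i (j ⊲ g)                       ≈⟨ commutes g i (j ⊲ g) ⟩
    (ρ g · X) i (j ⊲ g)                       ≈⟨ ρ-· X g i (j ⊲ g) ⟩
    U (T i ∙ g) * X (i ⊲ g) (j ⊲ g)           ∎

  TwistedInvariant⇒InCentraliser : ∀ X → TwistedInvariant X → InCentraliser tr lc X
  TwistedInvariant⇒InCentraliser X invariant g i j = begin
    (X · ρ g) i j                              ≈⟨ ·-ρ X g i j ⟩
    X i (j ⊲ g ⁻¹) * U (T (j ⊲ g ⁻¹) ∙ g)      ≈⟨ invariant g i (j ⊲ g ⁻¹) ⟩
    U (T i ∙ g) * X (i ⊲ g) (j ⊲ g ⁻¹ ⊲ g)     ≡⟨ ≡.cong (λ l → U (T i ∙ g) * X (i ⊲ g) l) (⊲-inverseˡ j g) ⟩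
    U (T i ∙ g) * X (i ⊲ g) j                  ≈⟨ ρ-· X g i j ⟨
    (ρ g · X) i j                              ∎

  ScaledMonomialCondition : Matrix → Set (c ⊔ ℓk)
  ScaledMonomialCondition X = ∀ g j → U g * X (𝔱 g) (j ⊲ g) ≈ X i₁ j * U (T j ∙ g)

  MonomialCondition⇒Scaled : ∀ X → MonomialCondition tr lc X → ScaledMonomialCondition X
  MonomialCondition⇒Scaled X condition g j = a≈b[vc]⇒ua≈bc K (U*U⁻¹≈1 g) (condition g j)

  Scaled⇒MonomialCondition : ∀ X → ScaledMonomialCondition X → MonomialCondition tr lc X
  Scaled⇒MonomialCondition X scaled g j = ua≈bc⇒a≈b[vc] K (U*U⁻¹≈1 g) (scaled g j)

  TwistedInvariant⇒Scaled : ∀ X → TwistedInvariant X → ScaledMonomialCondition X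
  TwistedInvariant⇒Scaled X invariant g j = begin
    U g * X (𝔱 g) (j ⊲ g)                  ≈⟨ *-cong (U-cong (T-i₁∙ g)) (reflexive (≡.cong (λ i → X i (j ⊲ g)) (i₁⊲ g))) ⟨
    U (T i₁ ∙ g) * X (i₁ ⊲ g) (j ⊲ g)      ≈⟨ invariant g i₁ j ⟨
    X i₁ j * U (T j ∙ g)                   ∎

  Scaled⇒TwistedInvariant : ∀ X → ScaledMonomialCondition X → TwistedInvariant X
  Scaled⇒TwistedInvariant X scaled g i j =
    ≡.subst (λ l → X i l * U (T l ∙ g) ≈ U (T i ∙ g) * X (i ⊲ g) (l ⊲ g))
            (⊲-inverseˡ j (T i)) (invariant-at (j ⊲ T i ⁻¹))
    where
    row : ∀ μ → X i (μ ⊲ T i) ≈ X i₁ μ * U (T μ ∙ T i)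
    row μ = begin
      X i (μ ⊲ T i)                  ≡⟨ ≡.cong (λ r → X r (μ ⊲ T i)) (𝔱-T i) ⟨
      X (𝔱 (T i)) (μ ⊲ T i)          ≈⟨ *-identityˡ _ ⟨
      1# * X (𝔱 (T i)) (μ ⊲ T i)     ≈⟨ *-congʳ (U-T i) ⟨
      U (T i) * X (𝔱 (T i)) (μ ⊲ T i)  ≈⟨ scaled (T i) μ ⟩
      X i₁ μ * U (T μ ∙ T i)         ∎

    invariant-at : ∀ μ → X i (μ ⊲ T i) * U (T (μ ⊲ T i) ∙ g) ≈ U (T i ∙ g) * X (i ⊲ g) (μ ⊲ T i ⊲ g)
    invariant-at μ = begin
      X i (μ ⊲ T i) * U (T (μ ⊲ T i) ∙ g)                 ≈⟨ *-congʳ (row μ) ⟩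
      (X i₁ μ * U (T μ ∙ T i)) * U (T (μ ⊲ T i) ∙ g)      ≈⟨ *-assoc _ _ _ ⟩
      X i₁ μ * (U (T μ ∙ T i) * U (T (μ ⊲ T i) ∙ g))      ≈⟨ *-congˡ (U-∙ (T μ ∙ T i) g) ⟨
      X i₁ μ * U ((T μ ∙ T i) ∙ g)                        ≈⟨ *-congˡ (U-cong (G.assoc (T μ) (T i) g)) ⟩
      X i₁ μ * U (T μ ∙ (T i ∙ g))                        ≈⟨ scaled (T i ∙ g) μ ⟨
      U (T i ∙ g) * X (i ⊲ g) (μ ⊲ (T i ∙ g))             ≡⟨ ≡.cong (λ l → U (T i ∙ g) * X (i ⊲ g) l) (⊲-∙ μ (T i) g) ⟩
      U (T i ∙ g) * X (i ⊲ g) (μ ⊲ T i ⊲ g)               ∎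

-- Only the finiteness of the index n is used, not that of G.
proposition3p2 : ∀ {c ℓ p k ℓk} (G : Group c ℓ) → IsFiniteGroup G →
    (K : CommutativeRing k ℓk) (H : Subgroup G p) (n : ℕ)
    (tr : RightTransversal G H n) (lc : LinearChar G H K)
    (M : Fin n → Fin n → CommutativeRing.Carrier K) →
    (InCentraliser tr lc M → MonomialCondition tr lc M)
      × (MonomialCondition tr lc M → InCentraliser tr lc M)
proposition3p2 G _ K H n tr lc M =
    Scaled⇒MonomialCondition M ∘ TwistedInvariant⇒Scaled M ∘ InCentraliser⇒TwistedInvariant M
  , TwistedInvariant⇒InCentraliser M ∘ Scaled⇒TwistedInvariant M ∘ MonomialCondition⇒Scaled M
  where open InducedRepresentation tr lc
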